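{- For $n\in\mathbb{N}_{+}$ let $$F_n(x,y,z)=(x+y+z)^{2n+1}+(-x+z-y)^{2n+1}+(x-y-z)^{2n+1}+(-x+y-z)^{2n+1}\in\mathbb{Z}[x,y,z].$$ Then for every $n\in\mathbb{N}_{+}$ and every prime $p$, $$\phi_p(F_n)=\begin{cases}\nu_2(n)+3, & \text{if } p=2,\\ 1, & \text{if } p>2 \text{ and } 2n+1=p^m \text{ for some } m\in\mathbb{N}_{+},\\ 0, & \text{otherwise}.\end{cases}$$ Moreover, $F_n(x,y,z)\equiv 0 \pmod{xyz}$, i.e. $xyz$ divides $F_n$ in $\mathbb{Z}[x,y,z]$.
   Context: For a prime $p$, $\nu_p$ denotes the usual $p$-adic valuation on integers. For a nonzero polynomial $F=\sum_\alpha a_\alpha \overline{X}^\alpha\in\mathbb{Z}[x_1,\dots,x_k]$, $\phi_p(F)=\min\{\nu_p(a_\alpha): a_\alpha\neq 0\}$, i.e. the largest $k\in\mathbb{N}$ such that $p^k$ divides every coefficient of $F$ (and $\phi_p(0)=\infty$). -}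

module Defs where

open import Data.Nat as ℕ using (ℕ; zero; suc; _≤_)
open import Data.Integer as ℤ using (ℤ; +_)
open import Data.Integer.Divisibility as ℤD using ()
open import Data.Nat.Divisibility as ℕD using ()
open import Data.List using (List; []; _∷_; _++_; map; concatMap)
open import Data.Product using (_×_; _,_; ∃)
open import Relation.Binary.PropositionalEquality using (_≡_)
open import Relation.Nullary using (Dec; yes; no)

Mono : Set
Mono = ℕ × ℕ × ℕ

_≟ᴹ_ : (α β : Mono) → Dec (α ≡ β)
(a , b , c) ≟ᴹ (a' , b' , c') with a ℕ.≟ a' | b ℕ.≟ b' | c ℕ.≟ c'
... | yes _≡_.refl | yes _≡_.refl | yes _≡_.refl = yes _≡_.refl
... | no ne | _ | _ = no (λ { _≡_.refl → ne _≡_.refl })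
... | yes _ | no ne | _ = no (λ { _≡_.refl → ne _≡_.refl })
... | yes _ | yes _ | no ne = no (λ { _≡_.refl → ne _≡_.refl })

_+ᴹ_ : Mono → Mono → Mono
(a , b , c) +ᴹ (a' , b' , c') = (a ℕ.+ a') , (b ℕ.+ b') , (c ℕ.+ c')

-- A polynomial in ℤ[x,y,z] as a formal (finite) sum of terms c·x^a y^b z^c.
Poly : Set
Poly = List (ℤ × Mono)

-- Coefficient of the monomial α (terms with the same exponent are added).
coeff : Poly → Mono → ℤ
coeff [] α = + 0
coeff ((c , β) ∷ t) α with β ≟ᴹ α
... | yes _ = c ℤ.+ coeff t α
... | no _  = coeff t α

_≈ᴾ_ : Poly → Poly → Set
P ≈ᴾ Q = ∀ α → coeff P α ≡ coeff Q α

const : ℤ → Poly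
const c = (c , (0 , 0 , 0)) ∷ []

X Y Z : Poly
X = (+ 1 , (1 , 0 , 0)) ∷ []
Y = (+ 1 , (0 , 1 , 0)) ∷ []
Z = (+ 1 , (0 , 0 , 1)) ∷ []

infixl 6 _⊕_ _⊖_
infixl 7 _⊗_
infixr 8 _^ᴾ_

_⊕_ : Poly → Poly → Poly
P ⊕ Q = P ++ Q

⊖_ : Poly → Poly
⊖ P = map (λ { (c , α) → (ℤ.- c , α) }) P

_⊖_ : Poly → Poly → Poly
P ⊖ Q = P ⊕ (⊖ Q)

_⊗_ : Poly → Poly → Poly
P ⊗ Q = concatMap (λ { (c , α) → map (λ { (d , β) → (c ℤ.* d , α +ᴹ β) }) Q }) P

_^ᴾ_ : Poly → ℕ → Poly
P ^ᴾ zero = const (+ 1)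
P ^ᴾ suc k = P ⊗ (P ^ᴾ k)

F : ℕ → Poly
F n = (X ⊕ Y ⊕ Z) ^ᴾ e ⊕ ((⊖ X) ⊕ Z ⊖ Y) ^ᴾ e ⊕ (X ⊖ Y ⊖ Z) ^ᴾ e ⊕ ((⊖ X) ⊕ Y ⊖ Z) ^ᴾ e
  where e = suc (2 ℕ.* n)

DividesAll : ℕ → Poly → ℕ → Set
DividesAll p P k = ∀ α → (+ (p ℕ.^ k)) ℤD.∣ coeff P α

PhiIs : ℕ → Poly → ℕ → Set
PhiIs p P k = DividesAll p P k × (∀ j → DividesAll p P j → j ≤ k)

ValIs : ℕ → ℕ → ℕ → Set
ValIs p n k = (p ℕ.^ k) ℕD.∣ n × (∀ j → (p ℕ.^ j) ℕD.∣ n → j ≤ k)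

module Submission where

-- Expanding the four powers, the coefficient of x^a y^b z^c in F_n is the multinomial coefficient
-- (a+b+c)!/(a! b! c!) times 1 + (-1)^(a+b) + (-1)^(b+c) + (-1)^(a+c).  As a+b+c = 2n+1 is odd, this
-- factor is 4 when a, b, c are all odd and 0 otherwise; so xyz divides F_n, and φ_p(F_n) is ν_p(4)
-- plus the least p-adic valuation of a multinomial coefficient with three odd parts summing to 2n+1.
-- The absorption identity a·M(a,b,c) = (a+b+c)·M(a-1,b,c) bounds these valuations from below
-- (by ν_2(n)+1 when p = 2, and by 1 when 2n+1 = p^m), and explicit odd compositions attain the bounds:
-- (1, 1, 2n-1) for p = 2; (q, q, (p-2)q) with pq = 2n+1; and, when 2n+1 = p^k r with p ∤ r > 1,
-- (p^k, p^(k+t), p^(k+t)(u-1)) where r-1 = p^t u with p ∤ u.  The last two are controlled modulo p by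
-- the Lucas congruence C(qs, qt) ≡ C(s, t) for q a power of p.

open import Defs

open import Data.Nat as ℕ
  using (ℕ; zero; suc; pred; _+_; _*_; _^_; _≤_; _<_; z≤n; s≤s; NonZero; parity)
open import Data.Nat.Properties
open import Data.Nat.Divisibility
open import Data.Nat.DivMod using (_%_; %-distribˡ-+; %-distribˡ-*; m<n⇒m%n≡m)
open import Data.Nat.Primality
  using (Prime; composite; euclidsLemma; prime⇒nonZero; prime⇒nonTrivial; prime[2])
open import Data.Nat.Combinatorics
  using (_C_; nCk+nC[k+1]≡[n+1]C[k+1]; nCn≡1; nC1≡n; k>n⇒nCk≡0; nCk≡nC[n∸k])
open import Data.Nat.Induction using (<-wellFounded)
open import Data.Nat.Tactic.RingSolver using (solve-∀)
open import Data.Parity.Base as ℙ using (Parity; 0ℙ; 1ℙ)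
import Data.Parity.Properties as ℙ
open import Data.Integer as ℤ using (ℤ; 0ℤ; 1ℤ; -1ℤ)
import Data.Integer.Properties as ℤP
import Data.Integer.Tactic.RingSolver as ℤ-Solver
open import Data.List.Base using (_∷_; []; map)
open import Data.Product using (_×_; _,_; ∃; ∃₂)
open import Data.Product.Properties using (,-injective)
open import Data.Sum using (inj₁; inj₂)
open import Data.Empty using (⊥-elim)
open import Function.Base using (_∘_)
open import Induction.WellFounded using (Acc; acc)
open import Relation.Binary.Definitions using (tri<; tri≈; tri>)
open import Relation.Binary.PropositionalEquality
open import Relation.Nullary using (¬_; Dec; yes; no; contradiction)
open import Relation.Nullary.Decidable using (_×-dec_)

-- Parity

Odd : ℕ → Set
Odd n = parity n ≡ 1ℙ

odd-* : ∀ {m n} → Odd m → Odd n → Odd (m * n)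
odd-* {m} {n} om on = trans (ℙ.*-homo-* m n) (cong₂ ℙ._*_ om on)

odd-^ : ∀ {m} k → Odd m → Odd (m ^ k)
odd-^     zero    _  = refl
odd-^ {m} (suc k) om = odd-* {m} {m ^ k} om (odd-^ k om)

odd-2n+1 : ∀ n → Odd (suc (2 * n))
odd-2n+1 n = trans (ℙ.+-homo-+ 1 (2 * n)) (cong (1ℙ ℙ.+_) (ℙ.*-homo-* 2 n))

odd-last : ∀ {a b c} → Odd (a + (b + c)) → Odd a → Odd b → Odd c
odd-last {a} {b} {c} o oa ob with parity c in pc
... | 1ℙ = refl
... | 0ℙ = contradiction (trans (sym o) even-sum) λ ()
  where
  even-sum : parity (a + (b + c)) ≡ 0ℙ
  even-sum = begin
    parity (a + (b + c))            ≡⟨ ℙ.+-homo-+ a (b + c) ⟩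
    parity a ℙ.+ parity (b + c)     ≡⟨ cong (parity a ℙ.+_) (ℙ.+-homo-+ b c) ⟩
    parity a ℙ.+ (parity b ℙ.+ parity c) ≡⟨ cong₂ (λ x y → x ℙ.+ (y ℙ.+ parity c)) oa ob ⟩
    1ℙ ℙ.+ (1ℙ ℙ.+ parity c)        ≡⟨ cong (λ x → 1ℙ ℙ.+ (1ℙ ℙ.+ x)) pc ⟩
    0ℙ                              ∎
    where open ≡-Reasoning

2∣⇒even : ∀ {n} → 2 ∣ n → parity n ≡ 0ℙ
2∣⇒even (divides-refl q) = trans (ℙ.*-homo-* q 2) (ℙ.*-zeroʳ (parity q))

even⇒2∣ : ∀ n → parity n ≡ 0ℙ → 2 ∣ n
even⇒2∣ zero          _ = 2 ∣0
even⇒2∣ (suc (suc n)) e = ∣m∣n⇒∣m+n (∣-refl {2}) (even⇒2∣ n e)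

odd⇒2∤ : ∀ {n} → Odd n → ¬ 2 ∣ n
odd⇒2∤ o 2∣n = contradiction (trans (sym o) (2∣⇒even 2∣n)) λ ()

odd-prime : ∀ {p} → Prime p → 2 < p → Odd p
odd-prime {p} p-prime 2<p with parity p in pp
... | 1ℙ = refl
... | 0ℙ = ⊥-elim (Prime.notComposite p-prime (composite 2<p (even⇒2∣ p pp)))

-- Binomial and multinomial coefficients

C-pascal : ∀ n k → suc n C suc k ≡ n C k + n C suc k
C-pascal n k = sym (nCk+nC[k+1]≡[n+1]C[k+1] n k)

C-absorb : ∀ n k → suc k * (suc n C suc k) ≡ suc n * (n C k)
C-absorb n       zero    = trans (*-identityˡ (suc n C 1)) (trans (nC1≡n (suc n)) (sym (*-identityʳ (suc n))))
C-absorb zero    (suc k) = *-zeroʳ (suc (suc k))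
C-absorb (suc n) (suc k) = begin
  suc (suc k) * (suc (suc n) C suc (suc k))  ≡⟨ cong (suc (suc k) *_) (C-pascal (suc n) (suc k)) ⟩
  suc (suc k) * (P + Q)                      ≡⟨ expand k P Q ⟩
  suc k * P + P + suc (suc k) * Q            ≡⟨ cong₂ (λ x y → x + P + y) (C-absorb n k) (C-absorb n (suc k)) ⟩
  suc n * (n C k) + P + suc n * (n C suc k)  ≡⟨ collect n (n C k) P (n C suc k) ⟩
  suc n * (n C k + n C suc k) + P            ≡⟨ cong (λ x → suc n * x + P) (C-pascal n k) ⟨
  suc n * P + P                              ≡⟨ +-comm (suc n * P) P ⟩
  suc (suc n) * P                            ∎
  where
  open ≡-Reasoning
  P = suc n C suc k
  Q = suc n C suc (suc k)
  expand : ∀ k P Q → suc (suc k) * (P + Q) ≡ suc k * P + P + suc (suc k) * Q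
  expand = solve-∀
  collect : ∀ n x P y → suc n * x + P + suc n * y ≡ suc n * (x + y) + P
  collect = solve-∀

C-pascal-pred : ∀ n .{{_ : NonZero n}} k → n C suc k ≡ pred n C k + pred n C suc k
C-pascal-pred (suc n) k = C-pascal n k

C-absorb-pred : ∀ n .{{_ : NonZero n}} k → suc k * (n C suc k) ≡ n * (pred n C k)
C-absorb-pred (suc n) k = C-absorb n k

C-sym : ∀ a s → (a + s) C a ≡ (a + s) C s
C-sym a s = trans (nCk≡nC[n∸k] (m≤m+n a s)) (cong ((a + s) C_) (m+n∸m≡n a s))

C-absorb-complement : ∀ a s → suc s * ((a + suc s) C a) ≡ (a + suc s) * ((a + s) C a)
C-absorb-complement a s = begin
  suc s * ((a + suc s) C a)        ≡⟨ cong (suc s *_) (C-sym a (suc s)) ⟩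
  suc s * ((a + suc s) C suc s)    ≡⟨ cong (λ n → suc s * (n C suc s)) (+-suc a s) ⟩
  suc s * (suc (a + s) C suc s)    ≡⟨ C-absorb (a + s) s ⟩
  suc (a + s) * ((a + s) C s)      ≡⟨ cong₂ _*_ (+-suc a s) (C-sym a s) ⟨
  (a + suc s) * ((a + s) C a)      ∎
  where open ≡-Reasoning

atPred : (ℕ → ℕ) → ℕ → ℕ
atPred f zero    = 0
atPred f (suc n) = f n

atPred-cong : ∀ {f g} n → (∀ {m} → n ≡ suc m → f m ≡ g m) → atPred f n ≡ atPred g n
atPred-cong zero    _ = refl
atPred-cong (suc n) h = h refl

atPred-zero : ∀ {f} n → (∀ {m} → n ≡ suc m → f m ≡ 0) → atPred f n ≡ 0
atPred-zero zero    _ = refl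
atPred-zero (suc n) h = h refl

*-atPred : ∀ {f g} k n → (∀ {m} → n ≡ suc m → k * f m ≡ g m) → k * atPred f n ≡ atPred g n
*-atPred k zero    _ = *-zeroʳ k
*-atPred k (suc n) h = h refl

C-pascal₂ : ∀ b c → b + c ≢ 0 →
            (b + c) C b ≡ atPred (λ b → (b + c) C b) b + atPred (λ c → (b + c) C b) c
C-pascal₂ zero    zero    b+c≢0 = ⊥-elim (b+c≢0 refl)
C-pascal₂ zero    (suc c) _     = refl
C-pascal₂ (suc b) zero    _     = begin
  suc (b + 0) C suc b             ≡⟨ C-pascal (b + 0) b ⟩
  (b + 0) C b + (b + 0) C suc b   ≡⟨ cong ((b + 0) C b +_) (k>n⇒nCk≡0 (s≤s (≤-reflexive (+-identityʳ b)))) ⟩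
  (b + 0) C b + 0                 ∎
  where open ≡-Reasoning
C-pascal₂ (suc b) (suc c) _     = trans (C-pascal (b + suc c) b) (cong (λ n → (b + suc c) C b + n C suc b) (+-suc b c))

multinomial : ℕ → ℕ → ℕ → ℕ
multinomial a b c = ((a + (b + c)) C a) * ((b + c) C b)

multinomial-absorbˡ : ∀ a b c → suc a * multinomial (suc a) b c ≡ (suc a + (b + c)) * multinomial a b c
multinomial-absorbˡ a b c = begin
  suc a * (((suc a + S) C suc a) * (S C b)) ≡⟨ *-assoc (suc a) ((suc a + S) C suc a) (S C b) ⟨
  suc a * ((suc a + S) C suc a) * (S C b)   ≡⟨ cong (_* (S C b)) (C-absorb (a + S) a) ⟩
  (suc a + S) * ((a + S) C a) * (S C b)     ≡⟨ *-assoc (suc a + S) ((a + S) C a) (S C b) ⟩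
  (suc a + S) * multinomial a b c           ∎
  where
  open ≡-Reasoning
  S = b + c

multinomial-absorbᵐ : ∀ a b c → suc b * multinomial a (suc b) c ≡ (a + (suc b + c)) * multinomial a b c
multinomial-absorbᵐ a b c = begin
  suc b * (A * (suc (b + c) C suc b))       ≡⟨ x*[y*z]≡y*[x*z] (suc b) A _ ⟩
  A * (suc b * (suc (b + c) C suc b))       ≡⟨ cong (A *_) (C-absorb (b + c) b) ⟩
  A * (suc (b + c) * ((b + c) C b))         ≡⟨ *-assoc A _ _ ⟨
  A * suc (b + c) * ((b + c) C b)           ≡⟨ cong (_* ((b + c) C b)) (*-comm A (suc (b + c))) ⟩
  suc (b + c) * A * ((b + c) C b)           ≡⟨ cong (_* ((b + c) C b)) (C-absorb-complement a (b + c)) ⟩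
  (a + suc (b + c)) * ((a + (b + c)) C a) * ((b + c) C b)  ≡⟨ *-assoc (a + suc (b + c)) _ _ ⟩
  (a + (suc b + c)) * multinomial a b c     ∎
  where
  open ≡-Reasoning
  A = (a + suc (b + c)) C a
  x*[y*z]≡y*[x*z] : ∀ x y z → x * (y * z) ≡ y * (x * z)
  x*[y*z]≡y*[x*z] = solve-∀

multinomial-absorb-ab : ∀ a b c → suc a * suc b * multinomial (suc a) (suc b) c ≡
                                  (suc a + (suc b + c)) * ((a + (suc b + c)) * multinomial a b c)
multinomial-absorb-ab a b c = begin
  suc a * suc b * multinomial (suc a) (suc b) c      ≡⟨ x*y*z≡y*[x*z] (suc a) (suc b) _ ⟩
  suc b * (suc a * multinomial (suc a) (suc b) c)    ≡⟨ cong (suc b *_) (multinomial-absorbˡ a (suc b) c) ⟩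
  suc b * (E * multinomial a (suc b) c)              ≡⟨ x*[y*z]≡y*[x*z] (suc b) E _ ⟩
  E * (suc b * multinomial a (suc b) c)              ≡⟨ cong (E *_) (multinomial-absorbᵐ a b c) ⟩
  E * ((a + (suc b + c)) * multinomial a b c)        ∎
  where
  open ≡-Reasoning
  E = suc a + (suc b + c)
  x*y*z≡y*[x*z] : ∀ x y z → x * y * z ≡ y * (x * z)
  x*y*z≡y*[x*z] = solve-∀
  x*[y*z]≡y*[x*z] : ∀ x y z → x * (y * z) ≡ y * (x * z)
  x*[y*z]≡y*[x*z] = solve-∀

sum-sucᵐ : ∀ a b c → a + (suc b + c) ≡ suc (a + (b + c))
sum-sucᵐ a b c = +-suc a (b + c)

sum-sucʳ : ∀ a b c → a + (b + suc c) ≡ suc (a + (b + c))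
sum-sucʳ a b c = trans (cong (a +_) (+-suc b c)) (+-suc a (b + c))

multinomial-pascal-tail′ : ∀ a b c → b + c ≢ 0 →
  ((a + (b + c)) C suc a) * ((b + c) C b) ≡
  atPred (λ b → multinomial (suc a) b c) b + atPred (λ c → multinomial (suc a) b c) c
multinomial-pascal-tail′ a b c b+c≢0 = begin
  K * ((b + c) C b)                                  ≡⟨ cong (K *_) (C-pascal₂ b c b+c≢0) ⟩
  K * (atPred (λ b → (b + c) C b) b + atPred (λ c → (b + c) C b) c)
    ≡⟨ *-distribˡ-+ K (atPred (λ b → (b + c) C b) b) _ ⟩
  K * atPred (λ b → (b + c) C b) b + K * atPred (λ c → (b + c) C b) c
    ≡⟨ cong₂ _+_ (*-atPred K b λ { {m} refl → cong (λ n → (n C suc a) * ((m + c) C m)) (sum-sucᵐ a m c) })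
                 (*-atPred K c λ { {m} refl → cong (λ n → (n C suc a) * ((b + m) C b)) (sum-sucʳ a b m) }) ⟩
  atPred (λ b → multinomial (suc a) b c) b + atPred (λ c → multinomial (suc a) b c) c ∎
  where
  open ≡-Reasoning
  K = (a + (b + c)) C suc a

multinomial-pascal-tail : ∀ a b c →
  ((a + (b + c)) C suc a) * ((b + c) C b) ≡
  atPred (λ b → multinomial (suc a) b c) b + atPred (λ c → multinomial (suc a) b c) c
multinomial-pascal-tail a zero    zero    = trans (*-identityʳ _) (k>n⇒nCk≡0 (s≤s (≤-reflexive (+-identityʳ a))))
multinomial-pascal-tail a zero    (suc c) = multinomial-pascal-tail′ a zero (suc c) λ ()
multinomial-pascal-tail a (suc b) c       = multinomial-pascal-tail′ a (suc b) c λ ()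

multinomial-pascal : ∀ a b c → a + (b + c) ≢ 0 →
  multinomial a b c ≡
  atPred (λ a → multinomial a b c) a + atPred (λ b → multinomial a b c) b + atPred (λ c → multinomial a b c) c
multinomial-pascal zero b c b+c≢0 = begin
  1 * ((b + c) C b)                                              ≡⟨ *-identityˡ _ ⟩
  (b + c) C b                                                    ≡⟨ C-pascal₂ b c b+c≢0 ⟩
  atPred (λ b → (b + c) C b) b + atPred (λ c → (b + c) C b) c    ≡⟨ cong₂ _+_ (one* b) (one* c) ⟩
  atPred (λ b → multinomial 0 b c) b + atPred (λ c → multinomial 0 b c) c ∎
  where
  open ≡-Reasoning
  one* : ∀ {f} n → atPred f n ≡ atPred (λ m → 1 * f m) n
  one* n = atPred-cong n λ _ → sym (*-identityˡ _)
multinomial-pascal (suc a) b c _ = begin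
  ((suc a + S) C suc a) * (S C b)                  ≡⟨ cong (_* (S C b)) (C-pascal (a + S) a) ⟩
  ((a + S) C a + (a + S) C suc a) * (S C b)        ≡⟨ *-distribʳ-+ (S C b) ((a + S) C a) _ ⟩
  multinomial a b c + ((a + S) C suc a) * (S C b)  ≡⟨ cong (multinomial a b c +_) (multinomial-pascal-tail a b c) ⟩
  multinomial a b c + (Pb + Pc)                      ≡⟨ +-assoc (multinomial a b c) Pb Pc ⟨
  multinomial a b c + Pb + Pc                        ∎
  where
  open ≡-Reasoning
  S = b + c
  Pb = atPred (λ b → multinomial (suc a) b c) b
  Pc = atPred (λ c → multinomial (suc a) b c) c

trinomial : ℕ → ℕ → ℕ → ℕ → ℕ
trinomial zero    zero zero zero = 1
trinomial zero    _    _    _    = 0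
trinomial (suc e) a    b    c    =
  atPred (λ a → trinomial e a b c) a + atPred (λ b → trinomial e a b c) b + atPred (λ c → trinomial e a b c) c

trinomial-off : ∀ e a b c → a + (b + c) ≢ e → trinomial e a b c ≡ 0
trinomial-off zero    zero    zero    zero    ≢e = ⊥-elim (≢e refl)
trinomial-off zero    (suc a) b       c       _  = refl
trinomial-off zero    zero    (suc b) c       _  = refl
trinomial-off zero    zero    zero    (suc c) _  = refl
trinomial-off (suc e) a       b       c       ≢e = cong₂ _+_ (cong₂ _+_
  (atPred-zero a λ { {m} refl → trinomial-off e m b c (≢e ∘ cong suc) })
  (atPred-zero b λ { {m} refl → trinomial-off e a m c (≢e ∘ trans (sum-sucᵐ a m c) ∘ cong suc) }))
  (atPred-zero c λ { {m} refl → trinomial-off e a b m (≢e ∘ trans (sum-sucʳ a b m) ∘ cong suc) })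

trinomial-on : ∀ e a b c → a + (b + c) ≡ e → trinomial e a b c ≡ multinomial a b c
trinomial-on zero    zero    zero    zero    _  = refl
trinomial-on (suc e) a       b       c       ≡e = begin
  atPred (λ a → trinomial e a b c) a + atPred (λ b → trinomial e a b c) b + atPred (λ c → trinomial e a b c) c
    ≡⟨ cong₂ _+_ (cong₂ _+_
         (atPred-cong a λ { {m} refl → trinomial-on e m b c (suc-injective ≡e) })
         (atPred-cong b λ { {m} refl → trinomial-on e a m c (suc-injective (trans (sym (sum-sucᵐ a m c)) ≡e)) }))
         (atPred-cong c λ { {m} refl → trinomial-on e a b m (suc-injective (trans (sym (sum-sucʳ a b m)) ≡e)) }) ⟩
  atPred (λ a → multinomial a b c) a + atPred (λ b → multinomial a b c) b + atPred (λ c → multinomial a b c) c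
    ≡⟨ multinomial-pascal a b c (λ ≡0 → 0≢1+n (trans (sym ≡0) ≡e)) ⟨
  multinomial a b c ∎
  where open ≡-Reasoning

-- Coefficients of F

coeff-⊕ : ∀ P Q α → coeff (P ⊕ Q) α ≡ coeff P α ℤ.+ coeff Q α
coeff-⊕ []            Q α = sym (ℤP.+-identityˡ (coeff Q α))
coeff-⊕ ((c , β) ∷ P) Q α with β ≟ᴹ α
... | yes _ = trans (cong (ℤ._+_ c) (coeff-⊕ P Q α)) (sym (ℤP.+-assoc c (coeff P α) (coeff Q α)))
... | no  _ = coeff-⊕ P Q α

coeff-∷-≢ : ∀ c β P α → β ≢ α → coeff ((c , β) ∷ P) α ≡ coeff P α
coeff-∷-≢ c β P α β≢α with β ≟ᴹ α
... | yes β≡α = ⊥-elim (β≢α β≡α)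
... | no  _   = refl

+ᴹ-cancelˡ : ∀ u {β γ} → u +ᴹ β ≡ u +ᴹ γ → β ≡ γ
+ᴹ-cancelˡ (u₁ , u₂ , u₃) eq with ,-injective eq
... | eq₁ , eq₂₃ with ,-injective eq₂₃
... | eq₂ , eq₃ = cong₂ _,_ (+-cancelˡ-≡ u₁ _ _ eq₁) (cong₂ _,_ (+-cancelˡ-≡ u₂ _ _ eq₂) (+-cancelˡ-≡ u₃ _ _ eq₃))

monomial : ℤ → Mono → Poly
monomial c u = (c , u) ∷ []

coeff-monomial-⊗ : ∀ c u Q γ → coeff (monomial c u ⊗ Q) (u +ᴹ γ) ≡ c ℤ.* coeff Q γ
coeff-monomial-⊗ c u []            γ = sym (ℤP.*-zeroʳ c)
coeff-monomial-⊗ c u ((d , β) ∷ Q) γ with (u +ᴹ β) ≟ᴹ (u +ᴹ γ) | β ≟ᴹ γ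
... | yes _   | yes _   = trans (cong (ℤ._+_ (c ℤ.* d)) (coeff-monomial-⊗ c u Q γ)) (sym (ℤP.*-distribˡ-+ c d _))
... | yes eq  | no  β≢γ = ⊥-elim (β≢γ (+ᴹ-cancelˡ u eq))
... | no  ≢eq | yes refl = ⊥-elim (≢eq refl)
... | no  _   | no  _   = coeff-monomial-⊗ c u Q γ

coeff-monomial-⊗-∉ : ∀ c u Q α → (∀ β → u +ᴹ β ≢ α) → coeff (monomial c u ⊗ Q) α ≡ 0ℤ
coeff-monomial-⊗-∉ c u []            α _ = refl
coeff-monomial-⊗-∉ c u ((d , β) ∷ Q) α ∉ =
  trans (coeff-∷-≢ (c ℤ.* d) (u +ᴹ β) (monomial c u ⊗ Q) α (∉ β)) (coeff-monomial-⊗-∉ c u Q α ∉)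

coeff-∷-⊗ : ∀ c u P Q α → coeff (((c , u) ∷ P) ⊗ Q) α ≡ coeff (monomial c u ⊗ Q) α ℤ.+ coeff (P ⊗ Q) α
coeff-∷-⊗ c u P Q α = begin
  coeff (cuQ ⊕ (P ⊗ Q)) α                    ≡⟨ coeff-⊕ cuQ (P ⊗ Q) α ⟩
  coeff cuQ α ℤ.+ coeff (P ⊗ Q) α            ≡⟨ cong (ℤ._+ coeff (P ⊗ Q) α) (ℤP.+-identityʳ (coeff cuQ α)) ⟨
  coeff cuQ α ℤ.+ 0ℤ ℤ.+ coeff (P ⊗ Q) α     ≡⟨ cong (ℤ._+ coeff (P ⊗ Q) α) (coeff-⊕ cuQ [] α) ⟨
  coeff (monomial c u ⊗ Q) α ℤ.+ coeff (P ⊗ Q) α ∎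
  where
  open ≡-Reasoning
  cuQ = map (λ { (d , β) → (c ℤ.* d , u +ᴹ β) }) Q

coeff-⊗-three : ∀ c₁ u₁ c₂ u₂ c₃ u₃ Q α →
  coeff (((c₁ , u₁) ∷ (c₂ , u₂) ∷ (c₃ , u₃) ∷ []) ⊗ Q) α ≡
  coeff (monomial c₁ u₁ ⊗ Q) α ℤ.+ coeff (monomial c₂ u₂ ⊗ Q) α ℤ.+ coeff (monomial c₃ u₃ ⊗ Q) α
coeff-⊗-three c₁ u₁ c₂ u₂ c₃ u₃ Q α = begin
  coeff (((c₁ , u₁) ∷ (c₂ , u₂) ∷ (c₃ , u₃) ∷ []) ⊗ Q) α
    ≡⟨ coeff-∷-⊗ c₁ u₁ ((c₂ , u₂) ∷ (c₃ , u₃) ∷ []) Q α ⟩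
  m₁ ℤ.+ coeff (((c₂ , u₂) ∷ (c₃ , u₃) ∷ []) ⊗ Q) α
    ≡⟨ cong (ℤ._+_ m₁) (coeff-∷-⊗ c₂ u₂ ((c₃ , u₃) ∷ []) Q α) ⟩
  m₁ ℤ.+ (m₂ ℤ.+ coeff (((c₃ , u₃) ∷ []) ⊗ Q) α)
    ≡⟨ cong (λ x → m₁ ℤ.+ (m₂ ℤ.+ x)) (coeff-∷-⊗ c₃ u₃ [] Q α) ⟩
  m₁ ℤ.+ (m₂ ℤ.+ (m₃ ℤ.+ 0ℤ))
    ≡⟨ reassociate m₁ m₂ m₃ ⟩
  m₁ ℤ.+ m₂ ℤ.+ m₃                                        ∎
  where
  open ≡-Reasoning
  m₁ = coeff (monomial c₁ u₁ ⊗ Q) α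
  m₂ = coeff (monomial c₂ u₂ ⊗ Q) α
  m₃ = coeff (monomial c₃ u₃ ⊗ Q) α
  reassociate : ∀ x y z → x ℤ.+ (y ℤ.+ (z ℤ.+ 0ℤ)) ≡ x ℤ.+ y ℤ.+ z
  reassociate = ℤ-Solver.solve-∀

linearForm : ℤ → ℤ → ℤ → Poly
linearForm sx sy sz = monomial sx (1 , 0 , 0) ⊕ monomial sy (0 , 1 , 0) ⊕ monomial sz (0 , 0 , 1)

module _ {sx sy sz : ℤ} (L : Poly) (L-linear : ∀ Q → (L ⊗ Q) ≈ᴾ (linearForm sx sy sz ⊗ Q)) where

  private
    S : ℕ → ℕ → ℕ → ℤ
    S a b c = sx ℤ.^ a ℤ.* sy ℤ.^ b ℤ.* sz ℤ.^ c

  coeff-linearForm-^ : ∀ e a b c → coeff (L ^ᴾ e) (a , b , c) ≡ S a b c ℤ.* ℤ.+ trinomial e a b c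
  coeff-linearForm-^ zero    zero    zero    zero    = refl
  coeff-linearForm-^ zero    (suc a) b       c       = trans (coeff-∷-≢ (ℤ.+ 1) (0 , 0 , 0) [] (suc a , b , c) λ ())
    (sym (ℤP.*-zeroʳ (S (suc a) b c)))
  coeff-linearForm-^ zero    zero    (suc b) c       = trans (coeff-∷-≢ (ℤ.+ 1) (0 , 0 , 0) [] (0 , suc b , c) λ ())
    (sym (ℤP.*-zeroʳ (S 0 (suc b) c)))
  coeff-linearForm-^ zero    zero    zero    (suc c) = trans (coeff-∷-≢ (ℤ.+ 1) (0 , 0 , 0) [] (0 , 0 , suc c) λ ())
    (sym (ℤP.*-zeroʳ (S 0 0 (suc c))))
  coeff-linearForm-^ (suc e) a       b       c       = begin
    coeff (L ⊗ P) (a , b , c)                                       ≡⟨ L-linear P (a , b , c) ⟩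
    coeff (linearForm sx sy sz ⊗ P) (a , b , c)                     ≡⟨ coeff-⊗-three sx _ sy _ sz _ P (a , b , c) ⟩
    coeff (monomial sx (1 , 0 , 0) ⊗ P) (a , b , c) ℤ.+ coeff (monomial sy (0 , 1 , 0) ⊗ P) (a , b , c)
      ℤ.+ coeff (monomial sz (0 , 0 , 1) ⊗ P) (a , b , c)          ≡⟨ cong₂ ℤ._+_ (cong₂ ℤ._+_ (via-x a) (via-y b)) (via-z c) ⟩
    S a b c ℤ.* ℤ.+ tx ℤ.+ S a b c ℤ.* ℤ.+ ty ℤ.+ S a b c ℤ.* ℤ.+ tz  ≡⟨ factor (S a b c) (ℤ.+ tx) (ℤ.+ ty) (ℤ.+ tz) ⟩
    S a b c ℤ.* (ℤ.+ tx ℤ.+ ℤ.+ ty ℤ.+ ℤ.+ tz)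
      ≡⟨ cong (S a b c ℤ.*_) (trans (cong (ℤ._+ ℤ.+ tz) (ℤP.pos-+ tx ty)) (ℤP.pos-+ (tx + ty) tz)) ⟨
    S a b c ℤ.* ℤ.+ (tx + ty + tz)                                  ∎
    where
    open ≡-Reasoning
    P = L ^ᴾ e
    tx = atPred (λ a → trinomial e a b c) a
    ty = atPred (λ b → trinomial e a b c) b
    tz = atPred (λ c → trinomial e a b c) c
    factor : ∀ s x y z → s ℤ.* x ℤ.+ s ℤ.* y ℤ.+ s ℤ.* z ≡ s ℤ.* (x ℤ.+ y ℤ.+ z)
    factor = ℤ-Solver.solve-∀
    via-x : ∀ a → coeff (monomial sx (1 , 0 , 0) ⊗ P) (a , b , c) ≡ S a b c ℤ.* ℤ.+ atPred (λ a → trinomial e a b c) a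
    via-x zero    = trans (coeff-monomial-⊗-∉ sx _ P _ λ _ ()) (sym (ℤP.*-zeroʳ (S 0 b c)))
    via-x (suc a) = trans (coeff-monomial-⊗ sx _ P (a , b , c))
      (trans (cong (sx ℤ.*_) (coeff-linearForm-^ e a b c)) (shuffle sx (sx ℤ.^ a) (sy ℤ.^ b) (sz ℤ.^ c) _))
      where shuffle : ∀ s x y z t → s ℤ.* (x ℤ.* y ℤ.* z ℤ.* t) ≡ s ℤ.* x ℤ.* y ℤ.* z ℤ.* t
            shuffle = ℤ-Solver.solve-∀
    via-y : ∀ b → coeff (monomial sy (0 , 1 , 0) ⊗ P) (a , b , c) ≡ S a b c ℤ.* ℤ.+ atPred (λ b → trinomial e a b c) b
    via-y zero    = trans (coeff-monomial-⊗-∉ sy _ P _ λ { (_ , _ , _) () }) (sym (ℤP.*-zeroʳ (S a 0 c)))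
    via-y (suc b) = trans (coeff-monomial-⊗ sy _ P (a , b , c))
      (trans (cong (sy ℤ.*_) (coeff-linearForm-^ e a b c)) (shuffle sy (sx ℤ.^ a) (sy ℤ.^ b) (sz ℤ.^ c) _))
      where shuffle : ∀ s x y z t → s ℤ.* (x ℤ.* y ℤ.* z ℤ.* t) ≡ x ℤ.* (s ℤ.* y) ℤ.* z ℤ.* t
            shuffle = ℤ-Solver.solve-∀
    via-z : ∀ c → coeff (monomial sz (0 , 0 , 1) ⊗ P) (a , b , c) ≡ S a b c ℤ.* ℤ.+ atPred (λ c → trinomial e a b c) c
    via-z zero    = trans (coeff-monomial-⊗-∉ sz _ P _ λ { (_ , _ , _) () }) (sym (ℤP.*-zeroʳ (S a b 0)))
    via-z (suc c) = trans (coeff-monomial-⊗ sz _ P (a , b , c))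
      (trans (cong (sz ℤ.*_) (coeff-linearForm-^ e a b c)) (shuffle sz (sx ℤ.^ a) (sy ℤ.^ b) (sz ℤ.^ c) _))
      where shuffle : ∀ s x y z t → s ℤ.* (x ℤ.* y ℤ.* z ℤ.* t) ≡ x ℤ.* y ℤ.* (s ℤ.* z) ℤ.* t
            shuffle = ℤ-Solver.solve-∀

sign : Parity → ℤ
sign 0ℙ = 1ℤ
sign 1ℙ = -1ℤ

-1^≡sign∘parity : ∀ n → -1ℤ ℤ.^ n ≡ sign (parity n)
-1^≡sign∘parity zero          = refl
-1^≡sign∘parity (suc zero)    = refl
-1^≡sign∘parity (suc (suc n)) = trans (-1*-1* (-1ℤ ℤ.^ n)) (-1^≡sign∘parity n)
  where
  -1*-1* : ∀ i → -1ℤ ℤ.* (-1ℤ ℤ.* i) ≡ i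
  -1*-1* = ℤ-Solver.solve-∀

weight : ℤ → ℤ → ℤ → ℤ
weight x y z = 1ℤ ℤ.+ x ℤ.* y ℤ.+ y ℤ.* z ℤ.+ x ℤ.* z

coeff-F : ∀ n a b c →
  coeff (F n) (a , b , c) ≡ weight (sign (parity a)) (sign (parity b)) (sign (parity c)) ℤ.* ℤ.+ trinomial (suc (2 * n)) a b c
coeff-F n a b c = begin
  coeff (F n) α
    ≡⟨ trans (coeff-⊕ (P₁ ⊕ P₂ ⊕ P₃) P₄ α) (cong (λ w → w ℤ.+ coeff P₄ α) (trans (coeff-⊕ (P₁ ⊕ P₂) P₃ α)
         (cong (λ w → w ℤ.+ coeff P₃ α) (coeff-⊕ P₁ P₂ α)))) ⟩
  coeff P₁ α ℤ.+ coeff P₂ α ℤ.+ coeff P₃ α ℤ.+ coeff P₄ α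
    ≡⟨ cong₂ ℤ._+_ (cong₂ ℤ._+_ (cong₂ ℤ._+_
         (coeff-linearForm-^ (X ⊕ Y ⊕ Z) (λ _ _ → refl) e a b c)
         (coeff-linearForm-^ ((⊖ X) ⊕ Z ⊖ Y) swap-yz e a b c))
         (coeff-linearForm-^ (X ⊖ Y ⊖ Z) (λ _ _ → refl) e a b c))
         (coeff-linearForm-^ ((⊖ X) ⊕ Y ⊖ Z) (λ _ _ → refl) e a b c) ⟩
  1ℤ ℤ.^ a ℤ.* 1ℤ ℤ.^ b ℤ.* 1ℤ ℤ.^ c ℤ.* t ℤ.+ x ℤ.* y ℤ.* 1ℤ ℤ.^ c ℤ.* t
    ℤ.+ 1ℤ ℤ.^ a ℤ.* y ℤ.* z ℤ.* t ℤ.+ x ℤ.* 1ℤ ℤ.^ b ℤ.* z ℤ.* t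
    ≡⟨ collect (ℤP.^-zeroˡ a) (ℤP.^-zeroˡ b) (ℤP.^-zeroˡ c) (-1^≡sign∘parity a) (-1^≡sign∘parity b) (-1^≡sign∘parity c) ⟩
  weight (sign (parity a)) (sign (parity b)) (sign (parity c)) ℤ.* t ∎
  where
  open ≡-Reasoning
  e = suc (2 * n)
  α = (a , b , c)
  P₁ = (X ⊕ Y ⊕ Z) ^ᴾ e
  P₂ = ((⊖ X) ⊕ Z ⊖ Y) ^ᴾ e
  P₃ = (X ⊖ Y ⊖ Z) ^ᴾ e
  P₄ = ((⊖ X) ⊕ Y ⊖ Z) ^ᴾ e
  t = ℤ.+ trinomial e a b c
  x = -1ℤ ℤ.^ a
  y = -1ℤ ℤ.^ b
  z = -1ℤ ℤ.^ c
  swap-yz : ∀ Q → (((⊖ X) ⊕ Z ⊖ Y) ⊗ Q) ≈ᴾ (linearForm -1ℤ -1ℤ 1ℤ ⊗ Q)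
  swap-yz Q β = begin
    coeff (((⊖ X) ⊕ Z ⊖ Y) ⊗ Q) β               ≡⟨ coeff-⊗-three -1ℤ _ 1ℤ _ -1ℤ _ Q β ⟩
    mx ℤ.+ mz ℤ.+ my                             ≡⟨ ℤP.+-assoc mx mz my ⟩
    mx ℤ.+ (mz ℤ.+ my)                           ≡⟨ cong (ℤ._+_ mx) (ℤP.+-comm mz my) ⟩
    mx ℤ.+ (my ℤ.+ mz)                           ≡⟨ ℤP.+-assoc mx my mz ⟨
    mx ℤ.+ my ℤ.+ mz                             ≡⟨ coeff-⊗-three -1ℤ _ -1ℤ _ 1ℤ _ Q β ⟨
    coeff (linearForm -1ℤ -1ℤ 1ℤ ⊗ Q) β          ∎
    where
    mx = coeff (monomial -1ℤ (1 , 0 , 0) ⊗ Q) β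
    my = coeff (monomial -1ℤ (0 , 1 , 0) ⊗ Q) β
    mz = coeff (monomial 1ℤ (0 , 0 , 1) ⊗ Q) β
  collect : ∀ {u v w x′ y′ z′} → u ≡ 1ℤ → v ≡ 1ℤ → w ≡ 1ℤ → x ≡ x′ → y ≡ y′ → z ≡ z′ →
    u ℤ.* v ℤ.* w ℤ.* t ℤ.+ x ℤ.* y ℤ.* w ℤ.* t ℤ.+ u ℤ.* y ℤ.* z ℤ.* t ℤ.+ x ℤ.* v ℤ.* z ℤ.* t ≡ weight x′ y′ z′ ℤ.* t
  collect refl refl refl refl refl refl = expand-weight x y z t
    where
    expand-weight : ∀ x y z t → 1ℤ ℤ.* 1ℤ ℤ.* 1ℤ ℤ.* t ℤ.+ x ℤ.* y ℤ.* 1ℤ ℤ.* t ℤ.+ 1ℤ ℤ.* y ℤ.* z ℤ.* t ℤ.+ x ℤ.* 1ℤ ℤ.* z ℤ.* t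
                         ≡ (1ℤ ℤ.+ x ℤ.* y ℤ.+ y ℤ.* z ℤ.+ x ℤ.* z) ℤ.* t
    expand-weight = ℤ-Solver.solve-∀

OddComposition : ℕ → ℕ → ℕ → ℕ → Set
OddComposition e a b c = Odd a × Odd b × Odd c × a + (b + c) ≡ e

weight-one-odd : ∀ pa pb pc → pa ℙ.+ (pb ℙ.+ pc) ≡ 1ℙ → ¬ (pa ≡ 1ℙ × pb ≡ 1ℙ × pc ≡ 1ℙ) →
                 weight (sign pa) (sign pb) (sign pc) ≡ 0ℤ
weight-one-odd 1ℙ 1ℙ 1ℙ _ not-all = ⊥-elim (not-all (refl , refl , refl))
weight-one-odd 1ℙ 0ℙ 0ℙ _ _       = refl
weight-one-odd 0ℙ 1ℙ 0ℙ _ _       = refl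
weight-one-odd 0ℙ 0ℙ 1ℙ _ _       = refl
weight-one-odd 1ℙ 1ℙ 0ℙ () _
weight-one-odd 1ℙ 0ℙ 1ℙ () _
weight-one-odd 0ℙ 1ℙ 1ℙ () _
weight-one-odd 0ℙ 0ℙ 0ℙ () _

coeff-F-odd : ∀ n a b c → OddComposition (suc (2 * n)) a b c → coeff (F n) (a , b , c) ≡ ℤ.+ (4 * multinomial a b c)
coeff-F-odd n a b c (oa , ob , oc , sum) = begin
  coeff (F n) (a , b , c)                                                         ≡⟨ coeff-F n a b c ⟩
  weight (sign (parity a)) (sign (parity b)) (sign (parity c)) ℤ.* ℤ.+ trinomial e a b c
    ≡⟨ cong₂ ℤ._*_ (cong₂ (λ u v → weight (sign u) (sign v) (sign (parity c))) oa ob) (cong (ℤ.+_) (trinomial-on e a b c sum)) ⟩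
  weight -1ℤ -1ℤ (sign (parity c)) ℤ.* ℤ.+ multinomial a b c
    ≡⟨ cong (λ p → weight -1ℤ -1ℤ (sign p) ℤ.* ℤ.+ multinomial a b c) oc ⟩
  ℤ.+ 4 ℤ.* ℤ.+ multinomial a b c                                                ≡⟨ ℤP.pos-* 4 (multinomial a b c) ⟨
  ℤ.+ (4 * multinomial a b c)                                                     ∎
  where
  open ≡-Reasoning
  e = suc (2 * n)

coeff-F-other : ∀ n a b c → ¬ OddComposition (suc (2 * n)) a b c → coeff (F n) (a , b , c) ≡ 0ℤ
coeff-F-other n a b c not-odd with a + (b + c) ≟ suc (2 * n)
... | no  sum≢e = trans (coeff-F n a b c) (trans (cong (w ℤ.*_) (cong ℤ.+_ (trinomial-off e a b c sum≢e))) (ℤP.*-zeroʳ w))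
  where
  e = suc (2 * n)
  w = weight (sign (parity a)) (sign (parity b)) (sign (parity c))
... | yes sum≡e = trans (coeff-F n a b c)
  (trans (cong (ℤ._* t) (weight-one-odd (parity a) (parity b) (parity c) odd-sum not-all)) (ℤP.*-zeroˡ t))
  where
  t = ℤ.+ trinomial (suc (2 * n)) a b c
  odd-sum : parity a ℙ.+ (parity b ℙ.+ parity c) ≡ 1ℙ
  odd-sum = begin
    parity a ℙ.+ (parity b ℙ.+ parity c) ≡⟨ cong (parity a ℙ.+_) (ℙ.+-homo-+ b c) ⟨
    parity a ℙ.+ parity (b + c)          ≡⟨ ℙ.+-homo-+ a (b + c) ⟨
    parity (a + (b + c))                 ≡⟨ cong parity sum≡e ⟩
    parity (suc (2 * n))                 ≡⟨ odd-2n+1 n ⟩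
    1ℙ                                   ∎
    where open ≡-Reasoning
  not-all : ¬ (Odd a × Odd b × Odd c)
  not-all (oa , ob , oc) = not-odd (oa , ob , oc , sum≡e)

divideXYZ : Poly → Poly
divideXYZ []                                   = []
divideXYZ ((d , (suc i , suc j , suc k)) ∷ P) = (d , (i , j , k)) ∷ divideXYZ P
divideXYZ (_                              ∷ P) = divideXYZ P

coeff-divideXYZ : ∀ P a b c → coeff (divideXYZ P) (a , b , c) ≡ coeff P (suc a , suc b , suc c)
coeff-divideXYZ [] a b c = refl
coeff-divideXYZ ((d , (suc i , suc j , suc k)) ∷ P) a b c
  with (i , j , k) ≟ᴹ (a , b , c) | (suc i , suc j , suc k) ≟ᴹ (suc a , suc b , suc c)
... | yes _    | yes _   = cong (ℤ._+_ d) (coeff-divideXYZ P a b c)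
... | yes refl | no ≢sss = ⊥-elim (≢sss refl)
... | no ≢ijk  | yes eq  = ⊥-elim (≢ijk (+ᴹ-cancelˡ (1 , 1 , 1) eq))
... | no _     | no _    = coeff-divideXYZ P a b c
coeff-divideXYZ ((d , (zero , j , k)) ∷ P) a b c =
  trans (coeff-divideXYZ P a b c) (sym (coeff-∷-≢ d (zero , j , k) P (suc a , suc b , suc c) λ ()))
coeff-divideXYZ ((d , (suc i , zero , k)) ∷ P) a b c =
  trans (coeff-divideXYZ P a b c) (sym (coeff-∷-≢ d (suc i , zero , k) P (suc a , suc b , suc c) λ ()))
coeff-divideXYZ ((d , (suc i , suc j , zero)) ∷ P) a b c =
  trans (coeff-divideXYZ P a b c) (sym (coeff-∷-≢ d (suc i , suc j , zero) P (suc a , suc b , suc c) λ ()))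

xyz-∣ : ∀ P → (∀ b c → coeff P (0 , b , c) ≡ 0ℤ) → (∀ a c → coeff P (suc a , 0 , c) ≡ 0ℤ) →
        (∀ a b → coeff P (suc a , suc b , 0) ≡ 0ℤ) → P ≈ᴾ (X ⊗ Y ⊗ Z ⊗ divideXYZ P)
xyz-∣ P x∤ y∤ z∤ (suc a , suc b , suc c) = sym (begin
  coeff (monomial 1ℤ (1 , 1 , 1) ⊗ divideXYZ P) ((1 , 1 , 1) +ᴹ (a , b , c)) ≡⟨ coeff-monomial-⊗ 1ℤ _ (divideXYZ P) (a , b , c) ⟩
  1ℤ ℤ.* coeff (divideXYZ P) (a , b , c)                                     ≡⟨ ℤP.*-identityˡ _ ⟩
  coeff (divideXYZ P) (a , b , c)                                            ≡⟨ coeff-divideXYZ P a b c ⟩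
  coeff P (suc a , suc b , suc c)                                            ∎)
  where open ≡-Reasoning
xyz-∣ P x∤ y∤ z∤ (zero , b , c)          = trans (x∤ b c) (sym (coeff-monomial-⊗-∉ 1ℤ _ (divideXYZ P) _ λ _ ()))
xyz-∣ P x∤ y∤ z∤ (suc a , zero , c)      = trans (y∤ a c) (sym (coeff-monomial-⊗-∉ 1ℤ _ (divideXYZ P) _ λ { (_ , _ , _) () }))
xyz-∣ P x∤ y∤ z∤ (suc a , suc b , zero)  = trans (z∤ a b) (sym (coeff-monomial-⊗-∉ 1ℤ _ (divideXYZ P) _ λ { (_ , _ , _) () }))

oddComposition? : ∀ e a b c → Dec (OddComposition e a b c)
oddComposition? e a b c = parity a ℙ.≟ 1ℙ ×-dec parity b ℙ.≟ 1ℙ ×-dec parity c ℙ.≟ 1ℙ ×-dec a + (b + c) ≟ e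

multinomials⇒dividesAll : ∀ n p k → (∀ a b c → OddComposition (suc (2 * n)) a b c → p ^ k ∣ 4 * multinomial a b c) →
                          DividesAll p (F n) k
multinomials⇒dividesAll n p k ∣M (a , b , c) with oddComposition? (suc (2 * n)) a b c
... | yes odd = subst (λ x → p ^ k ∣ ℤ.∣ x ∣) (sym (coeff-F-odd n a b c odd)) (∣M a b c odd)
... | no  odd̸ = subst (λ x → p ^ k ∣ ℤ.∣ x ∣) (sym (coeff-F-other n a b c odd̸)) ((p ^ k) ∣0)

dividesAll⇒multinomial : ∀ n p k → DividesAll p (F n) k →
                         ∀ a b c → OddComposition (suc (2 * n)) a b c → p ^ k ∣ 4 * multinomial a b c
dividesAll⇒multinomial n p k p^k∣F a b c odd = subst (λ x → p ^ k ∣ ℤ.∣ x ∣) (coeff-F-odd n a b c odd) (p^k∣F (a , b , c))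

xyz-∣-F : ∀ n → F n ≈ᴾ (X ⊗ Y ⊗ Z ⊗ divideXYZ (F n))
xyz-∣-F n = xyz-∣ (F n)
  (λ b c → coeff-F-other n 0 b c λ ())
  (λ a c → coeff-F-other n (suc a) 0 c λ ())
  (λ a b → coeff-F-other n (suc a) (suc b) 0 λ ())

-- Primes and prime powers

module _ {p : ℕ} (p-prime : Prime p) where

  private instance
    p≢0 : NonZero p
    p≢0 = prime⇒nonZero p-prime

  prime>1 : 1 < p
  prime>1 = ℕ.nonTrivial⇒n>1 p {{prime⇒nonTrivial p-prime}}

  prime∤1 : ¬ p ∣ 1
  prime∤1 p∣1 = <⇒≢ prime>1 (sym (∣1⇒≡1 p∣1))

  prime-∤-* : ∀ {m n} → ¬ p ∣ m → ¬ p ∣ n → ¬ p ∣ m * n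
  prime-∤-* {m} {n} p∤m p∤n p∣mn with euclidsLemma m n p-prime p∣mn
  ... | inj₁ p∣m = p∤m p∣m
  ... | inj₂ p∣n = p∤n p∣n

  prime-power-divisor : ∀ {m n} k → ¬ p ∣ m → p ^ k ∣ m * n → p ^ k ∣ n
  prime-power-divisor {m} {n} zero    _   _       = 1∣ n
  prime-power-divisor {m} {n} (suc k) p∤m p^k∣mn with euclidsLemma m n p-prime (∣-trans (m∣m*n (p ^ k)) p^k∣mn)
  ... | inj₁ p∣m             = contradiction p∣m p∤m
  ... | inj₂ (divides n′ refl) = subst (p ^ suc k ∣_) (*-comm p n′) (*-monoʳ-∣ p (prime-power-divisor k p∤m p^k∣mn′))
    where
    p^k∣mn′ : p ^ k ∣ m * n′
    p^k∣mn′ = *-cancelˡ-∣ p (subst (p * p ^ k ∣_) (x*[y*z]≡z*[x*y] m n′ p) p^k∣mn)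
      where x*[y*z]≡z*[x*y] : ∀ x y z → x * (y * z) ≡ z * (x * y)
            x*[y*z]≡z*[x*y] = solve-∀

  absorption⇒∣ : ∀ {m a x y} → a * x ≡ p ^ m * y → 0 < a → a < p ^ m → p ∣ x
  absorption⇒∣ {m} {a} {x} {y} eq 0<a a<p^m with p ∣? x
  ... | yes p∣x = p∣x
  ... | no  p∤x = contradiction (∣⇒≤ {{ℕ.>-nonZero 0<a}} p^m∣a) (<⇒≱ a<p^m)
    where
    p^m∣a : p ^ m ∣ a
    p^m∣a = prime-power-divisor m p∤x (subst (p ^ m ∣_) (trans (sym eq) (*-comm a x)) (m∣m*n y))

  prime∣multinomial : ∀ {a b c m} → suc a + (b + c) ≡ p ^ m → 0 < b → p ∣ multinomial (suc a) b c
  prime∣multinomial {a} {b} {c} {m} sum≡p^m 0<b = absorption⇒∣ {m = m}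
    (trans (multinomial-absorbˡ a b c) (cong (_* multinomial a b c) sum≡p^m))
    (s≤s z≤n) (subst (suc a <_) sum≡p^m (m<m+n (suc a) (<-≤-trans 0<b (m≤m+n b c))))

  prime^k∣multinomial : ∀ {a b c} k → ¬ p ∣ suc a * suc b → p ^ k ∣ a + (suc b + c) →
                        p ^ k ∣ multinomial (suc a) (suc b) c
  prime^k∣multinomial {a} {b} {c} k p∤ab p^k∣ = prime-power-divisor k p∤ab
    (subst (p ^ k ∣_) (sym (multinomial-absorb-ab a b c)) (∣n⇒∣m*n (suc a + (suc b + c)) (∣m⇒∣m*n (multinomial a b c) p^k∣)))

  factor-out : ∀ x → 0 < x → ∃₂ λ t u → ¬ p ∣ u × x ≡ p ^ t * u
  factor-out x = go x (<-wellFounded x)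
    where
    go : ∀ x → Acc _<_ x → 0 < x → ∃₂ λ t u → ¬ p ∣ u × x ≡ p ^ t * u
    go x (acc rec) 0<x with p ∣? x
    ... | no  p∤x = 0 , x , p∤x , sym (+-identityʳ x)
    ... | yes (divides (suc y) refl) with go (suc y) (rec (m<m*n (suc y) p prime>1)) (s≤s z≤n)
    ...   | t , u , p∤u , y≡ = suc t , u , p∤u , trans (cong (_* p) y≡) (x*y*z≡z*x*y (p ^ t) u p)
      where
      x*y*z≡z*x*y : ∀ x y z → x * y * z ≡ z * x * y
      x*y*z≡z*x*y = solve-∀

^-∣-^*-bound : ∀ {p} .{{_ : NonZero p}} i k {m} → (∀ l → p ^ l ∣ m → l ≤ k) → ∀ j → p ^ j ∣ p ^ i * m → j ≤ i + k
^-∣-^*-bound {p} i k {m} maximal j p^j∣ with j ≤? i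
... | yes j≤i = ≤-trans j≤i (m≤m+n i k)
... | no  j≰i with m≤n⇒∃[o]m+o≡n (<⇒≤ (≰⇒> j≰i))
...   | l , refl = +-monoʳ-≤ i (maximal l (*-cancelˡ-∣ (p ^ i) {{m^n≢0 p i}} (subst (_∣ p ^ i * m) (^-distribˡ-+-* p i l) p^j∣)))

odd-prime∤4 : ∀ {p} → Prime p → 2 < p → ¬ p ∣ 4
odd-prime∤4 p-prime 2<p p∣4 with euclidsLemma 2 2 p-prime p∣4
... | inj₁ p∣2 = <⇒≱ 2<p (∣⇒≤ p∣2)
... | inj₂ p∣2 = <⇒≱ 2<p (∣⇒≤ p∣2)

-- Binomial coefficients modulo a prime

infix 4 _≡_mod_
_≡_mod_ : ℕ → ℕ → (d : ℕ) → .{{NonZero d}} → Set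
m ≡ n mod d = m % d ≡ n % d

module Congruence (d : ℕ) .{{_ : NonZero d}} where

  ≡⇒≡-mod : ∀ {m n} → m ≡ n → m ≡ n mod d
  ≡⇒≡-mod = cong (_% d)

  +-cong-mod : ∀ {m m′ n n′} → m ≡ m′ mod d → n ≡ n′ mod d → m + n ≡ m′ + n′ mod d
  +-cong-mod {m} {m′} {n} {n′} m≡m′ n≡n′ = begin
    (m + n) % d                 ≡⟨ %-distribˡ-+ m n d ⟩
    (m % d + n % d) % d         ≡⟨ cong₂ (λ x y → (x + y) % d) m≡m′ n≡n′ ⟩
    (m′ % d + n′ % d) % d       ≡⟨ %-distribˡ-+ m′ n′ d ⟨
    (m′ + n′) % d               ∎
    where open ≡-Reasoning

  *-cong-mod : ∀ {m m′ n n′} → m ≡ m′ mod d → n ≡ n′ mod d → m * n ≡ m′ * n′ mod d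
  *-cong-mod {m} {m′} {n} {n′} m≡m′ n≡n′ = begin
    (m * n) % d                 ≡⟨ %-distribˡ-* m n d ⟩
    (m % d * (n % d)) % d       ≡⟨ cong₂ (λ x y → (x * y) % d) m≡m′ n≡n′ ⟩
    (m′ % d * (n′ % d)) % d     ≡⟨ %-distribˡ-* m′ n′ d ⟨
    (m′ * n′) % d               ∎
    where open ≡-Reasoning

  ∣⇒≡0-mod : ∀ {m} → d ∣ m → m ≡ 0 mod d
  ∣⇒≡0-mod {m} d∣m = trans (n∣m⇒m%n≡0 m d d∣m) (sym (m<n⇒m%n≡m (ℕ.>-nonZero⁻¹ d)))

  ≡-mod-∣ : ∀ {m n} → m ≡ n mod d → d ∣ m → d ∣ n
  ≡-mod-∣ {m} {n} m≡n d∣m = m%n≡0⇒n∣m n d (trans (sym m≡n) (n∣m⇒m%n≡0 m d d∣m))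

-- r C (j ∸ q), except that it is 0 (not r C 0) when j < q.
shiftedC : ℕ → ℕ → ℕ → ℕ
shiftedC r zero    j       = r C j
shiftedC r (suc q) zero    = 0
shiftedC r (suc q) (suc j) = shiftedC r q j

shiftedC-pascal : ∀ r q j → shiftedC (suc r) q (suc j) ≡ shiftedC r q j + shiftedC r q (suc j)
shiftedC-pascal r zero          j       = C-pascal r j
shiftedC-pascal r (suc zero)    zero    = refl
shiftedC-pascal r (suc (suc q)) zero    = refl
shiftedC-pascal r (suc q)       (suc j) = shiftedC-pascal r q j

shiftedC-+ : ∀ r q j → shiftedC r q (q + j) ≡ r C j
shiftedC-+ r zero    j = refl
shiftedC-+ r (suc q) j = shiftedC-+ r q j

shiftedC-< : ∀ r {q j} → j < q → shiftedC r q j ≡ 0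
shiftedC-< r {suc q} {zero}  _         = refl
shiftedC-< r {suc q} {suc j} (s≤s j<q) = shiftedC-< r j<q

shiftedC-diag : ∀ r q → shiftedC r q q ≡ 1
shiftedC-diag r zero    = refl
shiftedC-diag r (suc q) = shiftedC-diag r q

shiftedC-0-> : ∀ {q j} → q < j → shiftedC 0 q j ≡ 0
shiftedC-0-> {zero}  {suc j} _         = refl
shiftedC-0-> {suc q} {suc j} (s≤s q<j) = shiftedC-0-> q<j

module _ {p : ℕ} (p-prime : Prime p) (k : ℕ) where

  private instance
    p≢0 : NonZero p
    p≢0 = prime⇒nonZero p-prime
    p^k≢0 : NonZero (p ^ k)
    p^k≢0 = m^n≢0 p k

  private
    q = p ^ k
    q>0 : 0 < q
    q>0 = m^n>0 p k

  open Congruence p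

  prime-power-C-interior : ∀ {j} → suc j < q → p ∣ q C suc j
  prime-power-C-interior {j} j<q = absorption⇒∣ p-prime {m = k} (C-absorb-pred q j) (s≤s z≤n) j<q

  prime-power-pred-C : ∀ {j} → j < q → ¬ p ∣ pred q C j
  prime-power-pred-C {zero}  _         = prime∤1 p-prime
  prime-power-pred-C {suc j} sj<q p∣C  =
    prime-power-pred-C (<-trans (n<1+n j) sj<q)
      (∣m+n∣m⇒∣n (subst (p ∣_) (trans (C-pascal-pred q j) (+-comm (pred q C j) _)) (prime-power-C-interior sj<q)) p∣C)

  C-power-row : ∀ j → q C j ≡ 0 C j + shiftedC 0 q j mod p
  C-power-row zero    = ≡⇒≡-mod (cong suc (sym (shiftedC-< 0 q>0)))
  C-power-row (suc j) with <-cmp (suc j) q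
  ... | tri< j<q _ _ = trans (∣⇒≡0-mod (prime-power-C-interior j<q)) (≡⇒≡-mod (sym (shiftedC-< 0 j<q)))
  ... | tri≈ _ j≡q _ = ≡⇒≡-mod (subst (λ i → q C i ≡ 0 C i + shiftedC 0 q i) (sym j≡q)
    (trans (nCn≡1 q) (sym (cong₂ _+_ (k>n⇒nCk≡0 q>0) (shiftedC-diag 0 q)))))
  ... | tri> _ _ q<j = ≡⇒≡-mod (trans (k>n⇒nCk≡0 q<j) (sym (shiftedC-0-> q<j)))

  -- The coefficientwise form of (1 + x)^(q + r) ≡ (1 + x^q)(1 + x)^r.
  C-power-+ : ∀ r j → (q + r) C j ≡ r C j + shiftedC r q j mod p
  C-power-+ zero    j       = trans (≡⇒≡-mod (cong (_C j) (+-identityʳ q))) (C-power-row j)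
  C-power-+ (suc r) zero    = ≡⇒≡-mod (cong suc (sym (shiftedC-< (suc r) q>0)))
  C-power-+ (suc r) (suc j) = begin
    ((q + suc r) C suc j) % p                                   ≡⟨ cong (_% p) (trans (cong (_C suc j) (+-suc q r)) (C-pascal (q + r) j)) ⟩
    ((q + r) C j + (q + r) C suc j) % p                         ≡⟨ +-cong-mod (C-power-+ r j) (C-power-+ r (suc j)) ⟩
    (r C j + shiftedC r q j + (r C suc j + shiftedC r q (suc j))) % p
      ≡⟨ cong (_% p) (trans (+-exchange (r C j) _ _ _) (cong₂ _+_ (sym (C-pascal r j)) (sym (shiftedC-pascal r q j)))) ⟩
    (suc r C suc j + shiftedC (suc r) q (suc j)) % p            ∎
    where
    open ≡-Reasoning
    +-exchange : ∀ a b c d → a + b + (c + d) ≡ a + c + (b + d)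
    +-exchange = solve-∀

  C-power-* : ∀ s t → (q * s) C (q * t) ≡ s C t mod p
  C-power-* s       zero    = ≡⇒≡-mod (cong ((q * s) C_) (*-zeroʳ q))
  C-power-* zero    (suc t) = ≡⇒≡-mod (trans (cong (_C (q * suc t)) (*-zeroʳ q)) (k>n⇒nCk≡0 (<-≤-trans q>0 (m≤m*n q (suc t)))))
  C-power-* (suc s) (suc t) = begin
    ((q * suc s) C (q * suc t)) % p                              ≡⟨ cong₂ (λ m n → (m C n) % p) (*-suc q s) (*-suc q t) ⟩
    ((q + q * s) C (q + q * t)) % p                              ≡⟨ C-power-+ (q * s) (q + q * t) ⟩
    ((q * s) C (q + q * t) + shiftedC (q * s) q (q + q * t)) % p
      ≡⟨ cong₂ (λ m n → (m + n) % p) (cong ((q * s) C_) (*-suc q t)) (sym (shiftedC-+ (q * s) q (q * t))) ⟨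
    ((q * s) C (q * suc t) + (q * s) C (q * t)) % p              ≡⟨ +-cong-mod (C-power-* s (suc t)) (C-power-* s t) ⟩
    (s C suc t + s C t) % p                                      ≡⟨ cong (_% p) (trans (+-comm (s C suc t) (s C t)) (sym (C-pascal s t))) ⟩
    (suc s C suc t) % p                                          ∎
    where open ≡-Reasoning

  C-power-multiple : ∀ s → (q * s) C q ≡ s mod p
  C-power-multiple s =
    trans (≡⇒≡-mod (cong ((q * s) C_) (sym (*-identityʳ q)))) (trans (C-power-* s 1) (≡⇒≡-mod (nC1≡n s)))

-- The three cases

phi-2 : ∀ n → 1 ≤ n → ∀ k → ValIs 2 n k → PhiIs 2 (F n) (k + 3)
phi-2 (suc n′) _ k (2^k∣n , maximal) = multinomials⇒dividesAll n 2 (k + 3) lower , upper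
  where
  n = suc n′
  e = suc (2 * n)
  lower : ∀ a b c → OddComposition e a b c → 2 ^ (k + 3) ∣ 4 * multinomial a b c
  lower (suc a) (suc b) c (oa , ob , _ , sum) =
    subst (_∣ 4 * multinomial (suc a) (suc b) c) (sym 2^[k+3]≡4*2^[1+k]) (*-monoʳ-∣ 4
      (prime^k∣multinomial prime[2] (suc k) (odd⇒2∤ {suc a * suc b} (odd-* {suc a} {suc b} oa ob))
        (subst (2 ^ suc k ∣_) (sym (suc-injective sum)) (*-monoʳ-∣ 2 2^k∣n))))
    where
    2^[k+3]≡4*2^[1+k] : 2 ^ (k + 3) ≡ 4 * 2 ^ suc k
    2^[k+3]≡4*2^[1+k] = trans (^-distribˡ-+-* 2 k 3) (x*8≡4*[2*x] (2 ^ k))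
      where x*8≡4*[2*x] : ∀ x → x * 8 ≡ 4 * (2 * x)
            x*8≡4*[2*x] = solve-∀
  c = suc (2 * n′)
  sum : 1 + (1 + c) ≡ e
  sum = cong (suc ∘ suc) (sym (+-suc n′ (n′ + 0)))
  upper : ∀ j → DividesAll 2 (F n) j → j ≤ k + 3
  upper j 2^j∣F = subst (j ≤_) (+-comm 3 k) (^-∣-^*-bound 3 k ν₂[en]≤k j 2^j∣8en)
    where
    ν₂[en]≤k : ∀ l → 2 ^ l ∣ e * n → l ≤ k
    ν₂[en]≤k l 2^l∣en = maximal l (prime-power-divisor prime[2] l (odd⇒2∤ {e} (odd-2n+1 n)) 2^l∣en)
    4M≡8en : 4 * multinomial 1 1 c ≡ 2 ^ 3 * (e * n)
    4M≡8en = begin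
      4 * (((1 + (1 + c)) C 1) * ((1 + c) C 1)) ≡⟨ cong (4 *_) (cong₂ _*_ (nC1≡n (1 + (1 + c))) (nC1≡n (1 + c))) ⟩
      4 * ((1 + (1 + c)) * (1 + c))            ≡⟨ cong (4 *_) (cong₂ _*_ sum (suc-injective sum)) ⟩
      4 * (e * (2 * n))                        ≡⟨ 4*[x*[2*y]]≡8*[x*y] e n ⟩
      2 ^ 3 * (e * n)                          ∎
      where
      open ≡-Reasoning
      4*[x*[2*y]]≡8*[x*y] : ∀ x y → 4 * (x * (2 * y)) ≡ 8 * (x * y)
      4*[x*[2*y]]≡8*[x*y] = solve-∀
    2^j∣8en : 2 ^ j ∣ 2 ^ 3 * (e * n)
    2^j∣8en = subst (2 ^ j ∣_) 4M≡8en (dividesAll⇒multinomial n 2 j 2^j∣F 1 1 c (refl , refl , odd-2n+1 n′ , sum))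

module _ {p″ : ℕ} (p-prime : Prime (2 + p″)) (2<p : 2 < 2 + p″) (m : ℕ) where

  private
    p = 2 + p″
    q = p ^ m
    R = pred (p * q) C pred q
    W = (q + p″ * q) C q
    instance
      p≢0 : NonZero p
      p≢0 = _
      q≢0 : NonZero q
      q≢0 = m^n≢0 p m

  open Congruence p

  [pq]Cq≡p*R : (p * q) C q ≡ p * R
  [pq]Cq≡p*R = *-cancelˡ-≡ _ _ q (begin
    q * ((p * q) C q)                        ≡⟨ cong (λ i → i * ((p * q) C i)) (suc-pred q) ⟨
    suc (pred q) * ((p * q) C suc (pred q))  ≡⟨ C-absorb-pred (p * q) {{m*n≢0 p q}} (pred q) ⟩
    p * q * R                                ≡⟨ x*y*z≡y*[x*z] p q R ⟩
    q * (p * R)                              ∎)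
    where
    open ≡-Reasoning
    x*y*z≡y*[x*z] : ∀ x y z → x * y * z ≡ y * (x * z)
    x*y*z≡y*[x*z] = solve-∀

  p∤R : ¬ p ∣ R
  p∤R = prime-power-pred-C p-prime (suc m) (<-≤-trans (m≤pred[n]⇒suc[m]≤n ≤-refl) (m≤n*m q p))

  p∤W : ¬ p ∣ W
  p∤W p∣W = <⇒≱ (n<1+n (suc p″)) (∣⇒≤ (≡-mod-∣ W≡p-1 p∣W))
    where
    W≡p-1 : W ≡ suc p″ mod p
    W≡p-1 = trans (≡⇒≡-mod (cong (_C q) (trans (cong (q +_) (*-comm p″ q)) (sym (*-suc q p″)))))
                  (C-power-multiple p-prime m (suc p″))

  p²∤4*multinomial : ¬ p * p ∣ 4 * multinomial q q (p″ * q)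
  p²∤4*multinomial p²∣4M = prime-∤-* p-prime (prime-∤-* p-prime (odd-prime∤4 p-prime 2<p) p∤R) p∤W
    (*-cancelˡ-∣ p (subst (p * p ∣_) 4M≡p*4RW p²∣4M))
    where
    4M≡p*4RW : 4 * multinomial q q (p″ * q) ≡ p * (4 * R * W)
    4M≡p*4RW = trans (cong (λ x → 4 * (x * W)) [pq]Cq≡p*R) (4*[[x*y]*z]≡x*[4*y*z] p R W)
      where
      4*[[x*y]*z]≡x*[4*y*z] : ∀ x y z → 4 * (x * y * z) ≡ x * (4 * y * z)
      4*[[x*y]*z]≡x*[4*y*z] = solve-∀

phi-prime-power : ∀ n p m → Prime p → 2 < p → suc (2 * n) ≡ p ^ suc m → PhiIs p (F n) 1
phi-prime-power n p@(suc (suc p″)) m p-prime 2<p e≡p^[1+m] = multinomials⇒dividesAll n p 1 lower , upper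
  where
  e = suc (2 * n)
  lower : ∀ a b c → OddComposition e a b c → p ^ 1 ∣ 4 * multinomial a b c
  lower (suc a) b@(suc _) c (_ , _ , _ , sum) = subst (_∣ 4 * multinomial (suc a) b c) (sym (*-identityʳ p))
    (∣n⇒∣m*n 4 (prime∣multinomial p-prime {a} {b} {c} {suc m} (trans sum e≡p^[1+m]) (s≤s z≤n)))
  q = p ^ m
  odd-q : Odd q
  odd-q = odd-^ m (odd-prime p-prime 2<p)
  witness : OddComposition e q q (p″ * q)
  witness = odd-q , odd-q , odd-last {q} {q} {p″ * q} (subst Odd e≡p^[1+m] (odd-2n+1 n)) odd-q odd-q , sym e≡p^[1+m]
  upper : ∀ j → DividesAll p (F n) j → j ≤ 1
  upper zero          _     = z≤n
  upper (suc zero)    _     = ≤-refl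
  upper (suc (suc j)) p^j∣F = ⊥-elim (p²∤4*multinomial p-prime 2<p m
    (∣-trans (*-monoʳ-∣ p (m∣m*n {p} (p ^ j))) (dividesAll⇒multinomial n p (suc (suc j)) p^j∣F q q (p″ * q) witness)))

module _ {p : ℕ} (p-prime : Prime p) (2<p : 2 < p) where

  private instance
    p≢0 : NonZero p
    p≢0 = prime⇒nonZero p-prime
  open Congruence p

  split-witness : ∀ {e} k N t u → Odd e → e ≡ p ^ k * suc N → N ≡ p ^ t * suc u → ¬ p ∣ suc N → ¬ p ∣ suc u →
                  ∃₂ λ a b → ∃ λ c → OddComposition e a b c × ¬ p ∣ multinomial a b c
  split-witness {e} k N t u odd-e e≡ N≡ p∤r p∤u = a , b , c , (odd-a , odd-b , odd-c , sum) , p∤M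
    where
    a = p ^ k
    b = p ^ (k + t)
    c = b * u
    odd-p : Odd p
    odd-p = odd-prime p-prime 2<p
    odd-a : Odd a
    odd-a = odd-^ k odd-p
    odd-b : Odd b
    odd-b = odd-^ (k + t) odd-p
    b+c≡a*N : b + c ≡ a * N
    b+c≡a*N = begin
      b + b * u              ≡⟨ *-suc b u ⟨
      b * suc u              ≡⟨ cong (_* suc u) (^-distribˡ-+-* p k t) ⟩
      a * p ^ t * suc u      ≡⟨ *-assoc a (p ^ t) (suc u) ⟩
      a * (p ^ t * suc u)    ≡⟨ cong (a *_) N≡ ⟨
      a * N                  ∎
      where open ≡-Reasoning
    sum : a + (b + c) ≡ e
    sum = trans (cong (a +_) b+c≡a*N) (trans (sym (*-suc a N)) (sym e≡))
    odd-c : Odd c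
    odd-c = odd-last {a} {b} {c} (subst Odd (sym sum) odd-e) odd-a odd-b
    M≡ : multinomial a b c ≡ suc N * suc u mod p
    M≡ = *-cong-mod
      (trans (≡⇒≡-mod (cong (_C a) (trans sum e≡))) (C-power-multiple p-prime k (suc N)))
      (trans (≡⇒≡-mod (cong (_C b) (sym (*-suc b u)))) (C-power-multiple p-prime (k + t) (suc u)))
    p∤M : ¬ p ∣ multinomial a b c
    p∤M p∣M = prime-∤-* p-prime p∤r p∤u (≡-mod-∣ M≡ p∣M)

  non-prime-power-witness : ∀ n → 1 ≤ n → ¬ (∃ λ m → 1 ≤ m × suc (2 * n) ≡ p ^ m) →
                            ∃₂ λ a b → ∃ λ c → OddComposition (suc (2 * n)) a b c × ¬ p ∣ multinomial a b c
  non-prime-power-witness n@(suc _) _ not-power with factor-out p-prime (suc (2 * n)) (s≤s z≤n)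
  ... | k     , zero        , _   , e≡ = contradiction (trans e≡ (*-zeroʳ (p ^ k))) λ ()
  ... | zero  , suc zero    , _   , e≡ = contradiction (suc-injective e≡) λ ()
  ... | suc k , suc zero    , _   , e≡ = ⊥-elim (not-power (suc k , s≤s z≤n , trans e≡ (*-identityʳ _)))
  ... | k     , suc (suc N) , p∤r , e≡ with factor-out p-prime (suc N) (s≤s z≤n)
  ...   | t , zero  , _   , N≡ = contradiction (trans N≡ (*-zeroʳ (p ^ t))) λ ()
  ...   | t , suc u , p∤u , N≡ = split-witness k (suc N) t u (odd-2n+1 n) e≡ N≡ p∤r p∤u

phi-other : ∀ n p → 1 ≤ n → Prime p → 2 < p → ¬ (∃ λ m → 1 ≤ m × suc (2 * n) ≡ p ^ m) → PhiIs p (F n) 0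
phi-other n p 1≤n p-prime 2<p not-power = multinomials⇒dividesAll n p 0 (λ a b c _ → 1∣ _) , upper
  where
  upper : ∀ j → DividesAll p (F n) j → j ≤ 0
  upper zero    _     = z≤n
  upper (suc j) p^j∣F with non-prime-power-witness p-prime 2<p n 1≤n not-power
  ... | a , b , c , odd , p∤M = ⊥-elim (prime-∤-* p-prime (odd-prime∤4 p-prime 2<p) p∤M
    (∣-trans (m∣m*n (p ^ j)) (dividesAll⇒multinomial n p (suc j) p^j∣F a b c odd)))

theorem3p5 : (n : ℕ) → 1 ≤ n → (p : ℕ) → Prime p →
    ((p ≡ 2 → (k : ℕ) → ValIs 2 n k → PhiIs p (F n) (k + 3))
    × (2 < p → (∃ λ m → 1 ≤ m × suc (2 * n) ≡ p ^ m) → PhiIs p (F n) 1)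
    × (2 < p → ¬ (∃ λ m → 1 ≤ m × suc (2 * n) ≡ p ^ m) → PhiIs p (F n) 0))
    × (∃ λ G → F n ≈ᴾ (X ⊗ Y ⊗ Z ⊗ G))
theorem3p5 n 1≤n p p-prime =
  ( (λ { refl → phi-2 n 1≤n })
  , (λ { 2<p (suc m , _ , e≡p^m) → phi-prime-power n p m p-prime 2<p e≡p^m })
  , phi-other n p 1≤n p-prime )
  , divideXYZ (F n) , xyz-∣-F n
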